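{- Let $G$ be a $\tfrac12$-balanced bicolored graph containing neither a handle nor a non-monochromatic triangle. Let $M$ be the set of vertices of $G$ incident to at least one red edge and at least one blue edge, $R$ the set of non-isolated vertices all of whose incident edges are red, $B$ the set of non-isolated vertices all of whose incident edges are blue, and $m=|M|$. Then every triangle $T$ of $G$ satisfies $V(T)\cap M=\emptyset$. In particular, $e(G[M])\leq m^2/4$, and for every edge $\{u,v\}$ of $G$ with both endpoints in $R$ or both endpoints in $B$, $N(u)\cap N(v)\cap M=\emptyset$.
   Context: A bicolored graph is a simple graph whose edges are each colored red or blue; it is $\tfrac12$-balanced if each color class contains at least half of its edges. A handle is a monochromatic triangle together with an edge of the other color having exactly one endpoint on the triangle. A non-monochromatic triangle is a triangle whose edges do not all have the same color. $G$ contains a bicolored graph $F$ if there is an injective map $V(F)\to V(G)$ sending every edge of $F$ to an edge of $G$ of the same color. $N(u)$ denotes the neighborhood of $u$. -}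

module Defs where

open import Data.Nat using (ℕ; _*_; _≤_)
open import Data.Fin using (Fin; _<_; _<?_)
open import Data.Fin.Properties using (any?; all?)
open import Data.Maybe using (Maybe; just; nothing)
open import Data.Maybe.Properties using (≡-dec)
open import Data.List using (List; length; filter; cartesianProduct; allFin)
open import Data.Product using (Σ; ∃; _×_; _,_; proj₁; proj₂)
open import Data.Product.Properties using () 
open import Relation.Nullary using (¬_; Dec; yes; no)
open import Relation.Nullary.Decidable using (_×-dec_; ¬?; _→-dec_)
open import Relation.Unary using (Decidable)
open import Relation.Binary.PropositionalEquality using (_≡_; _≢_; refl)

data Color : Set where
  red blue : Color

_≟ᶜ_ : (c d : Color) → Dec (c ≡ d)
red ≟ᶜ red = yes refl
red ≟ᶜ blue = no λ ()
blue ≟ᶜ red = no λ ()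
blue ≟ᶜ blue = yes refl

other : Color → Color
other red = blue
other blue = red

-- A (finite, simple) bicolored graph on vertex set Fin n:
-- col i j = nothing  : no edge between i and j
-- col i j = just c   : an edge of colour c.
record BiGraph (n : ℕ) : Set where
  field
    col    : Fin n → Fin n → Maybe Color
    sym    : ∀ i j → col i j ≡ col j i
    loopless : ∀ i → col i i ≡ nothing

module _ {n : ℕ} (G : BiGraph n) where
  open BiGraph G

  ColEdge : Color → Fin n → Fin n → Set
  ColEdge c i j = col i j ≡ just c

  colEdge? : ∀ c i j → Dec (ColEdge c i j)
  colEdge? c i j = ≡-dec _≟ᶜ_ (col i j) (just c)

  Adj : Fin n → Fin n → Set
  Adj i j = col i j ≢ nothing

  adj? : ∀ i j → Dec (Adj i j)
  adj? i j = ¬? (≡-dec _≟ᶜ_ (col i j) nothing)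

  countPairs : {P : Fin n × Fin n → Set} → Decidable P → ℕ
  countPairs P? = length (filter P? (cartesianProduct (allFin n) (allFin n)))

  countVerts : {P : Fin n → Set} → Decidable P → ℕ
  countVerts P? = length (filter P? (allFin n))

  numEdges : ℕ
  numEdges = countPairs (λ p → (proj₁ p <? proj₂ p) ×-dec adj? (proj₁ p) (proj₂ p))

  numColEdges : Color → ℕ
  numColEdges c = countPairs (λ p → (proj₁ p <? proj₂ p) ×-dec colEdge? c (proj₁ p) (proj₂ p))

  HalfBalanced : Set
  HalfBalanced = ∀ c → numEdges ≤ 2 * numColEdges c

  IsTriangle : Fin n → Fin n → Fin n → Set
  IsTriangle a b c = a ≢ b × b ≢ c × a ≢ c × Adj a b × Adj b c × Adj a c

  MonoTriangle : Color → Fin n → Fin n → Fin n → Set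
  MonoTriangle k a b c =
    a ≢ b × b ≢ c × a ≢ c × ColEdge k a b × ColEdge k b c × ColEdge k a c

  HasHandle : Set
  HasHandle = Σ Color λ k → Σ (Fin n) λ a → Σ (Fin n) λ b → Σ (Fin n) λ c → Σ (Fin n) λ d →
    MonoTriangle k a b c × d ≢ a × d ≢ b × d ≢ c × ColEdge (other k) a d

  HasNonMonoTriangle : Set
  HasNonMonoTriangle = Σ (Fin n) λ a → Σ (Fin n) λ b → Σ (Fin n) λ c →
    IsTriangle a b c × ¬ (Σ Color λ k → MonoTriangle k a b c)

  Incident : Color → Fin n → Set
  Incident k v = ∃ λ w → ColEdge k v w

  incident? : ∀ k → Decidable (Incident k)
  incident? k v = any? (colEdge? k v)

  InM : Fin n → Set
  InM v = Incident red v × Incident blue v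

  inM? : Decidable InM
  inM? v = incident? red v ×-dec incident? blue v

  AllCol : Color → Fin n → Set
  AllCol k v = (∃ λ w → Adj v w) × (∀ w → Adj v w → ColEdge k v w)

  InR : Fin n → Set
  InR = AllCol red

  InB : Fin n → Set
  InB = AllCol blue

  m : ℕ
  m = countVerts inM?

  edgesInM : ℕ
  edgesInM = countPairs (λ p → (proj₁ p <? proj₂ p) ×-dec adj? (proj₁ p) (proj₂ p)
                                ×-dec inM? (proj₁ p) ×-dec inM? (proj₂ p))

module Submission where

-- Proof idea.
--   * A vertex of M lies on no monochromatic triangle: its edge of the other
--     colour would complete a handle.  Since every triangle of G is
--     monochromatic, no triangle meets M at all (first claim).
--   * The third claim is a special case: an edge uv together with a common
--     neighbour w is a triangle, so w ∉ M.  We prove Mantel's theorem for an arbitrary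
--     symmetric triangle-free decidable relation E on Fin n whose edges lie
--     inside a vertex set V: take x of maximum degree Δ and let S = V ∖ N(x).
--     Each edge has an endpoint in S (two neighbours of x are not adjacent),
--     so e ≤ |S|·Δ, while |S| + Δ ≤ |V|; AM–GM gives 4e ≤ |V|².

open import Defs
open import Data.Nat using (ℕ; zero; suc; _+_; _*_; _≤_; z≤n; s≤s)
open import Data.Nat.Properties
open import Data.Nat.Tactic.RingSolver using (solve-∀)
open import Data.Fin using (Fin) renaming (zero to fzero; _<_ to _<ᶠ_; _<?_ to _<?ᶠ_)
open import Data.Fin.Properties using () renaming (<-asym to <ᶠ-asym)
open import Data.List using (List; []; _∷_; length; filter; cartesianProduct; allFin; map; _++_)
open import Data.List.Extrema.Nat using (argmax; f[xs]≤f[argmax])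
open import Data.List.Membership.Propositional.Properties using (∈-allFin)
import Data.List.Relation.Unary.All as All
open import Data.Maybe using (just)
open import Data.Product using (Σ; ∃; _×_; _,_; proj₁; proj₂)
open import Data.Sum using (_⊎_; inj₁; inj₂)
open import Data.Empty using (⊥; ⊥-elim)
open import Relation.Nullary using (¬_; Dec; yes; no)
open import Relation.Nullary.Decidable using (_×-dec_; ¬?)
open import Relation.Binary.PropositionalEquality
  using (_≡_; _≢_; refl; sym; trans; cong; cong₂; subst; subst₂; module ≡-Reasoning)

sumOver : ∀ {a} {A : Set a} → List A → (A → ℕ) → ℕ
sumOver []       f = 0
sumOver (x ∷ xs) f = f x + sumOver xs f

𝟙 : ∀ {p} {P : Set p} → Dec P → ℕ
𝟙 (yes _) = 1
𝟙 (no _)  = 0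

module _ {a} {A : Set a} where

  count-filter : ∀ {p} {P : A → Set p} (P? : ∀ x → Dec (P x)) (xs : List A) →
                 length (filter P? xs) ≡ sumOver xs (λ x → 𝟙 (P? x))
  count-filter P? []       = refl
  count-filter P? (x ∷ xs) with P? x
  ... | yes _ = cong suc (count-filter P? xs)
  ... | no _  = count-filter P? xs

  sumOver-cong : (xs : List A) {f g : A → ℕ} → (∀ x → f x ≡ g x) → sumOver xs f ≡ sumOver xs g
  sumOver-cong []       f≡g = refl
  sumOver-cong (x ∷ xs) f≡g = cong₂ _+_ (f≡g x) (sumOver-cong xs f≡g)

  sumOver-mono : (xs : List A) {f g : A → ℕ} → (∀ x → f x ≤ g x) → sumOver xs f ≤ sumOver xs g
  sumOver-mono []       f≤g = z≤n
  sumOver-mono (x ∷ xs) f≤g = +-mono-≤ (f≤g x) (sumOver-mono xs f≤g)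

  sumOver-zero : (xs : List A) → sumOver xs (λ _ → 0) ≡ 0
  sumOver-zero []       = refl
  sumOver-zero (x ∷ xs) = sumOver-zero xs

  sumOver-++ : (xs ys : List A) (f : A → ℕ) → sumOver (xs ++ ys) f ≡ sumOver xs f + sumOver ys f
  sumOver-++ []       ys f = refl
  sumOver-++ (x ∷ xs) ys f = trans (cong (f x +_) (sumOver-++ xs ys f)) (sym (+-assoc (f x) _ _))

  sumOver-+ : (xs : List A) (f g : A → ℕ) →
              sumOver xs (λ x → f x + g x) ≡ sumOver xs f + sumOver xs g
  sumOver-+ []       f g = refl
  sumOver-+ (x ∷ xs) f g = begin
    f x + g x + sumOver xs (λ x → f x + g x)    ≡⟨ cong (f x + g x +_) (sumOver-+ xs f g) ⟩
    f x + g x + (sumOver xs f + sumOver xs g)   ≡⟨ +-assoc (f x) (g x) _ ⟩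
    f x + (g x + (sumOver xs f + sumOver xs g)) ≡⟨ cong (f x +_) (x+[y+z]≡y+[x+z] (g x) (sumOver xs f) (sumOver xs g)) ⟩
    f x + (sumOver xs f + (g x + sumOver xs g)) ≡⟨ +-assoc (f x) _ _ ⟨
    f x + sumOver xs f + (g x + sumOver xs g)   ∎
    where
    open ≡-Reasoning
    x+[y+z]≡y+[x+z] : ∀ x y z → x + (y + z) ≡ y + (x + z)
    x+[y+z]≡y+[x+z] x y z = trans (sym (+-assoc x y z))
                                  (trans (cong (_+ z) (+-comm x y)) (+-assoc y x z))

  sumOver-*ˡ : (xs : List A) (c : ℕ) (f : A → ℕ) → sumOver xs (λ x → c * f x) ≡ c * sumOver xs f
  sumOver-*ˡ []       c f = sym (*-zeroʳ c)
  sumOver-*ˡ (x ∷ xs) c f =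
    trans (cong (c * f x +_) (sumOver-*ˡ xs c f)) (sym (*-distribˡ-+ c (f x) _))

  sumOver-map : ∀ {b} {B : Set b} (g : B → A) (ys : List B) (f : A → ℕ) →
                sumOver (map g ys) f ≡ sumOver ys (λ y → f (g y))
  sumOver-map g []       f = refl
  sumOver-map g (y ∷ ys) f = cong (f (g y) +_) (sumOver-map g ys f)

module _ {a b} {A : Set a} {B : Set b} where

  sumOver-cartesianProduct : (xs : List A) (ys : List B) (f : A × B → ℕ) →
    sumOver (cartesianProduct xs ys) f ≡ sumOver xs (λ x → sumOver ys (λ y → f (x , y)))
  sumOver-cartesianProduct []       ys f = refl
  sumOver-cartesianProduct (x ∷ xs) ys f =
    trans (sumOver-++ (map (x ,_) ys) _ f)
          (cong₂ _+_ (sumOver-map (x ,_) ys f) (sumOver-cartesianProduct xs ys f))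

  sumOver-comm : (xs : List A) (ys : List B) (f : A → B → ℕ) →
    sumOver xs (λ x → sumOver ys (f x)) ≡ sumOver ys (λ y → sumOver xs (λ x → f x y))
  sumOver-comm []       ys f = sym (sumOver-zero ys)
  sumOver-comm (x ∷ xs) ys f =
    trans (cong (sumOver ys (f x) +_) (sumOver-comm xs ys f))
          (sym (sumOver-+ ys (f x) (λ y → sumOver xs (λ x → f x y))))

sumOver-transpose : ∀ {a} {A : Set a} (xs : List A) (f g : A → A → ℕ) →
  sumOver xs (λ i → sumOver xs (λ j → f i j + g j i)) ≡
  sumOver xs (λ i → sumOver xs (λ j → f i j + g i j))
sumOver-transpose {A = A} xs f g = begin
  ∑∑ (λ i j → f i j + g j i)                ≡⟨ sumOver-cong xs (λ i → sumOver-+ xs (f i) (λ j → g j i)) ⟩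
  sumOver xs (λ i → ∑ (f i) + ∑ (λ j → g j i)) ≡⟨ sumOver-+ xs _ _ ⟩
  ∑∑ f + ∑∑ (λ i j → g j i)                 ≡⟨ cong (∑∑ f +_) (sumOver-comm xs xs (λ i j → g j i)) ⟩
  ∑∑ f + ∑∑ g                               ≡⟨ sumOver-+ xs _ _ ⟨
  sumOver xs (λ i → ∑ (f i) + ∑ (g i))      ≡⟨ sumOver-cong xs (λ i → sumOver-+ xs (f i) (g i)) ⟨
  ∑∑ (λ i j → f i j + g i j)                ∎
  where
  open ≡-Reasoning
  ∑ : (A → ℕ) → ℕ
  ∑ = sumOver xs
  ∑∑ : (A → A → ℕ) → ℕ
  ∑∑ h = ∑ (λ i → ∑ (h i))

module _ {p q r} {P : Set p} {Q : Set q} {R : Set r} where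

  𝟙-cover : (P? : Dec P) (Q? : Dec Q) (R? : Dec R) → (P → Q ⊎ R) → 𝟙 P? ≤ 𝟙 Q? + 𝟙 R?
  𝟙-cover (no _)  _       _       _ = z≤n
  𝟙-cover (yes _) (yes _) _       _ = s≤s z≤n
  𝟙-cover (yes _) (no _)  (yes _) _ = s≤s z≤n
  𝟙-cover (yes p) (no ¬q) (no ¬r) P⇒Q⊎R with P⇒Q⊎R p
  ... | inj₁ q = ⊥-elim (¬q q)
  ... | inj₂ r = ⊥-elim (¬r r)

  𝟙-disjoint : (P? : Dec P) (Q? : Dec Q) (R? : Dec R) →
               (P → R) → (Q → R) → (P → Q → ⊥) → 𝟙 P? + 𝟙 Q? ≤ 𝟙 R?
  𝟙-disjoint (yes p) (yes q) _       _   _   excl = ⊥-elim (excl p q)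
  𝟙-disjoint (yes _) (no _)  (yes _) _   _   _    = ≤-refl
  𝟙-disjoint (yes p) (no _)  (no ¬r) P⇒R _   _    = ⊥-elim (¬r (P⇒R p))
  𝟙-disjoint (no _)  (yes _) (yes _) _   _   _    = ≤-refl
  𝟙-disjoint (no _)  (yes q) (no ¬r) _   Q⇒R _    = ⊥-elim (¬r (Q⇒R q))
  𝟙-disjoint (no _)  (no _)  _       _   _   _    = z≤n

𝟙-× : ∀ {p q} {P : Set p} {Q : Set q} (P? : Dec P) (Q? : Dec Q) → 𝟙 (P? ×-dec Q?) ≡ 𝟙 P? * 𝟙 Q?
𝟙-× (yes _) (yes _) = refl
𝟙-× (yes _) (no _)  = refl
𝟙-× (no _)  _       = refl

amgm-ordered : ∀ {a b} → a ≤ b → 4 * (a * b) ≤ (a + b) * (a + b)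
amgm-ordered {a} a≤b with m≤n⇒∃[o]m+o≡n a≤b
... | k , refl = subst (4 * (a * (a + k)) ≤_) (sym (square-expansion a k)) (m≤m+n _ (k * k))
  where
  square-expansion : ∀ a k → (a + (a + k)) * (a + (a + k)) ≡ 4 * (a * (a + k)) + k * k
  square-expansion = solve-∀

amgm : ∀ a b → 4 * (a * b) ≤ (a + b) * (a + b)
amgm a b with ≤-total a b
... | inj₁ a≤b = amgm-ordered a≤b
... | inj₂ b≤a = subst₂ (λ ab s → 4 * ab ≤ s * s) (*-comm b a) (+-comm b a) (amgm-ordered b≤a)

-- The number of unordered pairs {i, j} related by E, and the size of V,
-- counted exactly as Defs counts edges and vertices.
edgeCount : ∀ {n} {E : Fin n → Fin n → Set} → (∀ i j → Dec (E i j)) → ℕ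
edgeCount {n} E? = length (filter (λ p → (proj₁ p <?ᶠ proj₂ p) ×-dec E? (proj₁ p) (proj₂ p))
                                  (cartesianProduct (allFin n) (allFin n)))

vertexCount : ∀ {n} {V : Fin n → Set} → (∀ i → Dec (V i)) → ℕ
vertexCount {n} V? = length (filter V? (allFin n))

maximiser : ∀ {n} (f : Fin (suc n) → ℕ) → ∃ λ x → ∀ i → f i ≤ f x
maximiser {n} f =
  argmax f fzero (allFin (suc n)) ,
  λ i → All.lookup (f[xs]≤f[argmax] {f = f} fzero (allFin (suc n))) (∈-allFin i)

module Mantel {n : ℕ} {E : Fin n → Fin n → Set} (E? : ∀ i j → Dec (E i j))
              (E-sym : ∀ {i j} → E i j → E j i)
              (triangle-free : ∀ {a b c} → E a b → E b c → E a c → ⊥)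
              {V : Fin n → Set} (V? : ∀ i → Dec (V i))
              (E⇒V : ∀ {i j} → E i j → V i) where

  L : List (Fin n)
  L = allFin n

  degree : Fin n → ℕ
  degree i = sumOver L (λ j → 𝟙 (E? i j))

  module _ (x : Fin n) (x-max : ∀ i → degree i ≤ degree x) where

    -- S = V ∖ N(x): every edge has an endpoint in S.
    S : Fin n → Set
    S i = V i × ¬ E x i

    S? : ∀ i → Dec (S i)
    S? i = V? i ×-dec ¬? (E? x i)

    forward? : ∀ i j → Dec (i <ᶠ j × E i j × S i)
    forward?  i j = (i <?ᶠ j) ×-dec E? i j ×-dec S? i
    backward? : ∀ i j → Dec (j <ᶠ i × E i j × S i)
    backward? i j = (j <?ᶠ i) ×-dec E? i j ×-dec S? i

    edge-covered : ∀ i j → 𝟙 ((i <?ᶠ j) ×-dec E? i j) ≤ 𝟙 (forward? i j) + 𝟙 (backward? j i)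
    edge-covered i j = 𝟙-cover _ (forward? i j) (backward? j i) cover
      where
      cover : i <ᶠ j × E i j → (i <ᶠ j × E i j × S i) ⊎ (i <ᶠ j × E j i × S j)
      cover (i<j , eij) with E? x i | E? x j
      ... | no ¬exi  | _        = inj₁ (i<j , eij , E⇒V eij , ¬exi)
      ... | yes _    | no ¬exj  = inj₂ (i<j , E-sym eij , E⇒V (E-sym eij) , ¬exj)
      ... | yes exi  | yes exj  = ⊥-elim (triangle-free exi eij exj)

    edges-at : ∀ i → sumOver L (λ j → 𝟙 (forward? i j) + 𝟙 (backward? i j)) ≤ 𝟙 (S? i) * degree x
    edges-at i = begin
      sumOver L (λ j → 𝟙 (forward? i j) + 𝟙 (backward? i j))
        ≤⟨ sumOver-mono L (λ j → 𝟙-disjoint (forward? i j) (backward? i j) (S? i ×-dec E? i j)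
                                   (λ (_ , eij , si) → si , eij) (λ (_ , eij , si) → si , eij)
                                   (λ (i<j , _) (j<i , _) → <ᶠ-asym i<j j<i)) ⟩
      sumOver L (λ j → 𝟙 (S? i ×-dec E? i j)) ≡⟨ sumOver-cong L (λ j → 𝟙-× (S? i) (E? i j)) ⟩
      sumOver L (λ j → 𝟙 (S? i) * 𝟙 (E? i j)) ≡⟨ sumOver-*ˡ L (𝟙 (S? i)) (λ j → 𝟙 (E? i j)) ⟩
      𝟙 (S? i) * degree i                     ≤⟨ *-monoʳ-≤ (𝟙 (S? i)) (x-max i) ⟩
      𝟙 (S? i) * degree x                     ∎
      where open ≤-Reasoning

    s : ℕ
    s = sumOver L (λ i → 𝟙 (S? i))

    edges≤sΔ : edgeCount E? ≤ s * degree x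
    edges≤sΔ = begin
      edgeCount E?
        ≡⟨ count-filter _ (cartesianProduct L L) ⟩
      sumOver (cartesianProduct L L) _
        ≡⟨ sumOver-cartesianProduct L L _ ⟩
      sumOver L (λ i → sumOver L (λ j → 𝟙 ((i <?ᶠ j) ×-dec E? i j)))
        ≤⟨ sumOver-mono L (λ i → sumOver-mono L (edge-covered i)) ⟩
      sumOver L (λ i → sumOver L (λ j → 𝟙 (forward? i j) + 𝟙 (backward? j i)))
        ≡⟨ sumOver-transpose L (λ i j → 𝟙 (forward? i j)) (λ i j → 𝟙 (backward? i j)) ⟩
      sumOver L (λ i → sumOver L (λ j → 𝟙 (forward? i j) + 𝟙 (backward? i j)))
        ≤⟨ sumOver-mono L edges-at ⟩
      sumOver L (λ i → 𝟙 (S? i) * degree x)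
        ≡⟨ sumOver-cong L (λ i → *-comm (𝟙 (S? i)) (degree x)) ⟩
      sumOver L (λ i → degree x * 𝟙 (S? i))
        ≡⟨ sumOver-*ˡ L (degree x) (λ i → 𝟙 (S? i)) ⟩
      degree x * s
        ≡⟨ *-comm (degree x) s ⟩
      s * degree x ∎
      where open ≤-Reasoning

    -- S and N(x) are disjoint subsets of V.
    s+Δ≤|V| : s + degree x ≤ vertexCount V?
    s+Δ≤|V| = subst₂ _≤_ (sumOver-+ L (λ i → 𝟙 (S? i)) (λ i → 𝟙 (E? x i)))
                         (sym (count-filter V? L))
                 (sumOver-mono L (λ i → 𝟙-disjoint (S? i) (E? x i) (V? i)
                                          proj₁ (λ exi → E⇒V (E-sym exi)) (λ (_ , ¬exi) exi → ¬exi exi)))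

    mantel-at : 4 * edgeCount E? ≤ vertexCount V? * vertexCount V?
    mantel-at = begin
      4 * edgeCount E?                      ≤⟨ *-monoʳ-≤ 4 edges≤sΔ ⟩
      4 * (s * degree x)                    ≤⟨ amgm s (degree x) ⟩
      (s + degree x) * (s + degree x)       ≤⟨ *-mono-≤ s+Δ≤|V| s+Δ≤|V| ⟩
      vertexCount V? * vertexCount V?       ∎
      where open ≤-Reasoning

mantel : ∀ n {E : Fin n → Fin n → Set} (E? : ∀ i j → Dec (E i j)) →
         (∀ {i j} → E i j → E j i) → (∀ {a b c} → E a b → E b c → E a c → ⊥) →
         {V : Fin n → Set} (V? : ∀ i → Dec (V i)) → (∀ {i j} → E i j → V i) →
         4 * edgeCount E? ≤ vertexCount V? * vertexCount V?
mantel zero    E? E-sym tri-free V? E⇒V = z≤n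
mantel (suc n) E? E-sym tri-free V? E⇒V = mantel-at (proj₁ max-degree) (proj₂ max-degree)
  where
  open Mantel E? E-sym tri-free V? E⇒V
  max-degree : ∃ λ x → ∀ i → degree i ≤ degree x
  max-degree = maximiser degree

other-≢ : ∀ k → just (other k) ≢ just k
other-≢ red  ()
other-≢ blue ()

module _ {n : ℕ} (G : BiGraph n) where
  open BiGraph G renaming (sym to col-sym)

  adj-sym : ∀ {i j} → Adj G i j → Adj G j i
  adj-sym {i} {j} aij eq = aij (trans (col-sym i j) eq)

  adj-irrefl : ∀ {i j} → Adj G i j → i ≢ j
  adj-irrefl {i} aii refl = aii (loopless i)

  colEdge-adj : ∀ {k i j} → ColEdge G k i j → Adj G i j
  colEdge-adj eij eq with trans (sym eij) eq
  ... | ()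

  triangle : ∀ {a b c} → Adj G a b → Adj G b c → Adj G a c → IsTriangle G a b c
  triangle ab bc ac = adj-irrefl ab , adj-irrefl bc , adj-irrefl ac , ab , bc , ac

  rotate : ∀ {a b c} → IsTriangle G a b c → IsTriangle G b c a
  rotate (_ , _ , _ , ab , bc , ac) = triangle bc (adj-sym ac) (adj-sym ab)

  M-incident : ∀ {v} → InM G v → ∀ k → Incident G k v
  M-incident (r , _) red  = r
  M-incident (_ , b) blue = b

  -- A vertex of M on a monochromatic triangle spans a handle with its edge
  -- of the other colour.
  mono-apex-handle : ∀ {k a b c} → MonoTriangle G k a b c → InM G a → HasHandle G
  mono-apex-handle {k} {a} {b} {c} mt@(_ , _ , _ , eab , _ , eac) a∈M =
    k , a , b , c , d , mt , adj-irrefl (adj-sym (colEdge-adj ead)) ,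
    (λ { refl → other-≢ k (trans (sym ead) eab) }) ,
    (λ { refl → other-≢ k (trans (sym ead) eac) }) , ead
    where
    d : Fin n
    d = proj₁ (M-incident a∈M (other k))
    ead : ColEdge G (other k) a d
    ead = proj₂ (M-incident a∈M (other k))

  apex-not-in-M : ¬ HasHandle G → ¬ HasNonMonoTriangle G →
                  ∀ {a b c} → IsTriangle G a b c → ¬ InM G a
  apex-not-in-M no-handle no-nonmono {a} {b} {c} tri a∈M =
    no-nonmono (a , b , c , tri , λ (_ , mt) → no-handle (mono-apex-handle mt a∈M))

lemma4p3 : (n : ℕ) (G : BiGraph n) → HalfBalanced G → ¬ HasHandle G → ¬ HasNonMonoTriangle G →
    ((a b c : Fin n) → IsTriangle G a b c → ¬ InM G a × ¬ InM G b × ¬ InM G c)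
    × (4 * edgesInM G ≤ m G * m G)
    × ((u v : Fin n) → Adj G u v → (InR G u × InR G v) ⊎ (InB G u × InB G v) →
        ¬ (Σ (Fin n) λ w → Adj G u w × Adj G v w × InM G w))
lemma4p3 n G _ no-handle no-nonmono = triangles-avoid-M , edges-in-M , common-neighbours-avoid-M
  where
  not-in-M : ∀ {a b c} → IsTriangle G a b c → ¬ InM G a
  not-in-M = apex-not-in-M G no-handle no-nonmono

  triangles-avoid-M : (a b c : Fin n) → IsTriangle G a b c → ¬ InM G a × ¬ InM G b × ¬ InM G c
  triangles-avoid-M a b c tri = not-in-M tri , not-in-M (rotate G tri) , not-in-M (rotate G (rotate G tri))

  -- G[M] is triangle-free, so Mantel's theorem applies.
  edges-in-M : 4 * edgesInM G ≤ m G * m G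
  edges-in-M = mantel n (λ i j → adj? G i j ×-dec inM? G i ×-dec inM? G j)
    (λ (aij , i∈M , j∈M) → adj-sym G aij , j∈M , i∈M)
    (λ (ab , a∈M , _) (bc , _) (ac , _) → not-in-M (triangle G ab bc ac) a∈M)
    (inM? G) (λ (_ , i∈M , _) → i∈M)

  common-neighbours-avoid-M : (u v : Fin n) → Adj G u v → (InR G u × InR G v) ⊎ (InB G u × InB G v) →
                              ¬ (Σ (Fin n) λ w → Adj G u w × Adj G v w × InM G w)
  common-neighbours-avoid-M u v uv _ (w , uw , vw , w∈M) =
    not-in-M (rotate G (rotate G (triangle G uv vw uw))) w∈M
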